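{- Let $G$ and $H$ be graphs without isolated vertices. Then \[ min_D(G\square H)\leq min_D(G)\,|V(H)|+min_D(H)\,|V(G)|-2\,min_D(G)\,min_D(H).\]
   Context: All graphs are finite and simple. In the irreversible majority conversion process on a graph $G$, every vertex is black or white at each discrete time step $t=0,1,2,\ldots$. A black vertex stays black forever. A white vertex $v$ of degree $\deg_G(v)\geq 1$ becomes black at time $t$ if at least $\deg_G(v)/2$ of its neighbors are black at time $t-1$. An isolated vertex never changes color. A dynamo of $G$ is a set $D\subseteq V(G)$ such that, if exactly the vertices of $D$ are black at time $0$, then every vertex of $G$ is eventually black. $min_D(G)$ denotes the minimum size of a dynamo of $G$. The Cartesian product $G\square H$ has vertex set $V(G)\times V(H)$. In it, $(u,u')$ and $(v,v')$ are adjacent if and only if either $u=v$ and $u'v'\in E(H)$, or $u'=v'$ and $uv\in E(G)$. -}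

module Defs where

open import Data.Nat using (ℕ; zero; suc; _+_; _*_; _≤_; _≤?_)
open import Data.Bool using (Bool; true; false; _∧_; _∨_; if_then_else_)
open import Data.Fin using (Fin; zero; suc; remQuot)
open import Data.Fin.Properties using (_≟_)
open import Data.Product using (_×_; _,_; ∃)
open import Relation.Nullary.Decidable using (⌊_⌋)
open import Relation.Binary.PropositionalEquality using (_≡_)

record Graph : Set where
  field
    n   : ℕ
    adj : Fin n → Fin n → Bool
open Graph public

IsSimple : Graph → Set
IsSimple G = (∀ u v → adj G u v ≡ adj G v u) × (∀ v → adj G v v ≡ false)

Subset : ℕ → Set
Subset n = Fin n → Bool

count : ∀ {n} → Subset n → ℕ
count {zero}  S = 0
count {suc n} S = (if S zero then 1 else 0) + count (λ i → S (suc i))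

deg : (G : Graph) → Fin (n G) → ℕ
deg G v = count (adj G v)

NoIsolated : Graph → Set
NoIsolated G = ∀ v → 1 ≤ deg G v

blackNbrs : (G : Graph) → Subset (n G) → Fin (n G) → ℕ
blackNbrs G B v = count (λ w → adj G v w ∧ B w)

-- one step of the irreversible majority process: a white vertex with
-- deg ≥ 1 turns black iff at least deg/2 of its neighbours are black,
-- i.e. 2 * (#black neighbours) ≥ deg.
step : (G : Graph) → Subset (n G) → Subset (n G)
step G B v = B v ∨ (⌊ 1 ≤? deg G v ⌋ ∧ ⌊ deg G v ≤? 2 * blackNbrs G B v ⌋)

iter : (G : Graph) → ℕ → Subset (n G) → Subset (n G)
iter G zero    B = B
iter G (suc t) B = step G (iter G t B)

IsDynamo : (G : Graph) → Subset (n G) → Set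
IsDynamo G D = ∃ λ t → ∀ v → iter G t D v ≡ true

IsMinDynamoSize : Graph → ℕ → Set
IsMinDynamoSize G k = (∃ λ D → IsDynamo G D × count D ≡ k) × (∀ D → IsDynamo G D → k ≤ count D)

-- Cartesian product G □ H on Fin (n G * n H), vertex i ↔ remQuot i = (u , u')
_□_ : Graph → Graph → Graph
G □ H = record
  { n   = n G * n H
  ; adj = λ i j → adjP (remQuot (n H) i) (remQuot (n H) j)
  }
  where
  adjP : Fin (n G) × Fin (n H) → Fin (n G) × Fin (n H) → Bool
  adjP (u , u') (v , v') = (⌊ u ≟ v ⌋ ∧ adj H u' v') ∨ (⌊ u' ≟ v' ⌋ ∧ adj G u v)

-- Take minimum dynamos DG of G and DH of H. Minimality forces every u ∈ DG to have more
-- than half of its neighbours outside DG: otherwise u would turn black in the first step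
-- from DG ∖ {u}, which would then be a smaller dynamo. Now colour (u , u') black iff exactly
-- one of u ∈ DG, u' ∈ DH holds. A vertex of DG × DH then has a black majority in both its
-- G-fibre and its H-fibre, so it is black at time 1. By induction, if u is black at time i
-- in G and u' at time j in H, then (u , u') is black at time i + j + 1 in G □ H: unless u or
-- u' was black a step earlier, both gained a black majority, and the corresponding fibre
-- neighbours of (u , u') are black at time i + j. The set has a (|V(H)| - b) + (|V(G)| - a) b
-- elements.

module Submission where

open import Defs
open import Data.Bool using (Bool; true; false; not; _∧_; _∨_; _xor_; if_then_else_)
open import Data.Bool.Properties using (∧-comm; ∧-identityʳ; ∧-zeroʳ; ∨-identityʳ; xor-comm)
open import Data.Fin using (Fin; zero; suc; combine; remQuot; _↑ˡ_; _↑ʳ_; punchIn)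
open import Data.Fin.Properties using (_≟_; punchInᵢ≢i; remQuot-combine; combine-remQuot)
open import Data.Nat using (ℕ; zero; suc; _+_; _*_; _≤_; _≤′_; _≤?_; z≤n; s≤s; ≤′-refl; ≤′-step)
open import Data.Nat.Properties hiding (_≟_)
open import Data.Nat.Tactic.RingSolver using (solve-∀)
open import Data.Product using (_×_; _,_; uncurry)
open import Data.Sum using (_⊎_; inj₁; inj₂)
open import Function using (_∘_; case_of_)
open import Relation.Binary.PropositionalEquality
open import Relation.Nullary using (¬_; yes; no; contradiction)
open import Relation.Nullary.Decidable using (Dec; ⌊_⌋; isYes≗does; dec-true; dec-false)
open import Algebra.Properties.CommutativeMonoid.Sum +-0-commutativeMonoid
  using (sum; sum-syntax; sum-cong-≗; sum-remove; sum-replicate-zero; ∑-distrib-+; ∑-comm)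

private
  variable
    m k : ℕ

⌊⌋-true : ∀ {P : Set} (P? : Dec P) → P → ⌊ P? ⌋ ≡ true
⌊⌋-true P? p = trans (isYes≗does P?) (dec-true P? p)

⌊⌋-false : ∀ {P : Set} (P? : Dec P) → ¬ P → ⌊ P? ⌋ ≡ false
⌊⌋-false P? ¬p = trans (isYes≗does P?) (dec-false P? ¬p)

bit : Bool → ℕ
bit b = if b then 1 else 0

count≡∑bit : (S : Subset k) → count S ≡ ∑[ i < k ] bit (S i)
count≡∑bit {zero}  S = refl
count≡∑bit {suc k} S = cong (bit (S zero) +_) (count≡∑bit (S ∘ suc))

count-cong : {S T : Subset k} → (∀ i → S i ≡ T i) → count S ≡ count T
count-cong {S = S} {T} S≗T = begin
  count S              ≡⟨ count≡∑bit S ⟩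
  ∑[ i < _ ] bit (S i) ≡⟨ sum-cong-≗ (cong bit ∘ S≗T) ⟩
  ∑[ i < _ ] bit (T i) ≡⟨ count≡∑bit T ⟨
  count T              ∎
  where open ≡-Reasoning

count-split : (S T : Subset k) → count S ≡ count (λ i → S i ∧ T i) + count (λ i → S i ∧ not (T i))
count-split S T = begin
  count S                                            ≡⟨ count≡∑bit S ⟩
  ∑[ i < _ ] bit (S i)                               ≡⟨ sum-cong-≗ (λ i → bit-split (S i) (T i)) ⟩
  ∑[ i < _ ] (bit (S∧T i) + bit (S∧¬T i))            ≡⟨ ∑-distrib-+ (bit ∘ S∧T) (bit ∘ S∧¬T) ⟩
  ∑[ i < _ ] bit (S∧T i) + ∑[ i < _ ] bit (S∧¬T i)   ≡⟨ cong₂ _+_ (count≡∑bit S∧T) (count≡∑bit S∧¬T) ⟨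
  count S∧T + count S∧¬T                             ∎
  where
  open ≡-Reasoning
  S∧T S∧¬T : Subset _
  S∧T  i = S i ∧ T i
  S∧¬T i = S i ∧ not (T i)
  bit-split : ∀ s t → bit s ≡ bit (s ∧ t) + bit (s ∧ not t)
  bit-split false t     = refl
  bit-split true  false = refl
  bit-split true  true  = refl

_⊆_ : Subset k → Subset k → Set
S ⊆ T = ∀ i → S i ≡ true → T i ≡ true

count-mono : {S T : Subset k} → S ⊆ T → count S ≤ count T
count-mono {S = S} {T} S⊆T = begin
  count S                                                   ≡⟨ count-cong T∧S≡S ⟨
  count (λ i → T i ∧ S i)                                   ≤⟨ m≤m+n _ _ ⟩
  count (λ i → T i ∧ S i) + count (λ i → T i ∧ not (S i))   ≡⟨ count-split T S ⟨
  count T                                                   ∎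
  where
  open ≤-Reasoning
  T∧S≡S : ∀ i → T i ∧ S i ≡ S i
  T∧S≡S i with S i in Si
  ... | false = ∧-zeroʳ (T i)
  ... | true  rewrite S⊆T i Si = refl

count-complement : (S : Subset k) → count S + count (not ∘ S) ≡ k
count-complement {k} S = trans (sym (count-split (λ _ → true) S)) (count-true k)
  where
  count-true : ∀ k → count {k} (λ _ → true) ≡ k
  count-true zero    = refl
  count-true (suc k) = cong suc (count-true k)

sum-δ : (t : Fin k → ℕ) (u : Fin k) → (∀ w → w ≢ u → t w ≡ 0) → sum t ≡ t u
sum-δ {suc k} t u off = begin
  sum t                           ≡⟨ sum-remove {i = u} t ⟩
  t u + sum (t ∘ punchIn u)       ≡⟨ cong (t u +_) (sum-cong-≗ (λ w → off _ (punchInᵢ≢i u w))) ⟩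
  t u + ∑[ _ < k ] 0              ≡⟨ cong (t u +_) (sum-replicate-zero k) ⟩
  t u + 0                         ≡⟨ +-identityʳ (t u) ⟩
  t u                             ∎
  where open ≡-Reasoning

∑-bit-≟ : (u : Fin k) (S : Subset k) → ∑[ w < k ] bit (⌊ u ≟ w ⌋ ∧ S w) ≡ bit (S u)
∑-bit-≟ u S = trans (sum-δ _ u off) (cong (λ b → bit (b ∧ S u)) (⌊⌋-true (u ≟ u) refl))
  where
  off : ∀ w → w ≢ u → bit (⌊ u ≟ w ⌋ ∧ S w) ≡ 0
  off w w≢u = cong (λ b → bit (b ∧ S w)) (⌊⌋-false (u ≟ w) (w≢u ∘ sym))

sum-↑ : ∀ m (t : Fin (m + k) → ℕ) → sum t ≡ sum (t ∘ (_↑ˡ k)) + sum (t ∘ (m ↑ʳ_))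
sum-↑ zero    t = refl
sum-↑ (suc m) t = trans (cong (t zero +_) (sum-↑ m (t ∘ suc))) (sym (+-assoc (t zero) _ _))

sum-combine : (t : Fin (m * k) → ℕ) → sum t ≡ ∑[ u < m ] ∑[ u' < k ] t (combine u u')
sum-combine {zero}      t = refl
sum-combine {suc m} {k} t =
  trans (sum-↑ k t) (cong (sum (t ∘ (_↑ˡ (m * k))) +_) (sum-combine {m} (t ∘ (k ↑ʳ_))))

count-combine : ∀ {m k} (S : Subset (m * k)) →
                count S ≡ ∑[ u < m ] count (λ u' → S (combine u u'))
count-combine {m} {k} S = begin
  count S                                         ≡⟨ count≡∑bit S ⟩
  ∑[ i < m * k ] bit (S i)                        ≡⟨ sum-combine {m} (bit ∘ S) ⟩
  ∑[ u < m ] ∑[ u' < k ] bit (S (combine u u'))   ≡⟨ sum-cong-≗ {m} (count≡∑bit ∘ fibre) ⟨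
  ∑[ u < m ] count (fibre u)                      ∎
  where
  open ≡-Reasoning
  fibre : Fin m → Subset k
  fibre u u' = S (combine u u')

∑-if : (A : Subset k) (x y : ℕ) →
       ∑[ i < k ] (if A i then x else y) ≡ count A * x + count (not ∘ A) * y
∑-if {zero}  A x y = refl
∑-if {suc k} A x y with A zero
... | true  = trans (cong (x +_) (∑-if (A ∘ suc) x y)) (sym (+-assoc x _ _))
... | false = trans (cong (y +_) (∑-if (A ∘ suc) x y))
                    (+-left-comm y (count (A ∘ suc) * x) (count (not ∘ A ∘ suc) * y))
  where
  +-left-comm : ∀ y p q → y + (p + q) ≡ p + (y + q)
  +-left-comm = solve-∀

_⊕_ : Subset m → Subset k → Subset (m * k)
_⊕_ {m} {k} A B i = uncurry (λ u u' → A u xor B u') (remQuot {m} k i)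

⊕-combine : (A : Subset m) (B : Subset k) (u : Fin m) (u' : Fin k) →
            (A ⊕ B) (combine u u') ≡ A u xor B u'
⊕-combine A B u u' = cong (uncurry λ u u' → A u xor B u') (remQuot-combine u u')

count-⊕ : (A : Subset m) (B : Subset k) →
          count (A ⊕ B) ≡ count A * count (not ∘ B) + count (not ∘ A) * count B
count-⊕ {m} {k} A B = begin
  count (A ⊕ B)                                            ≡⟨ count-combine {m} {k} (A ⊕ B) ⟩
  ∑[ u < m ] count (λ u' → (A ⊕ B) (combine u u'))         ≡⟨ sum-cong-≗ (λ u → count-cong (⊕-combine A B u)) ⟩
  ∑[ u < m ] count (λ u' → A u xor B u')                   ≡⟨ sum-cong-≗ (count-xor ∘ A) ⟩
  ∑[ u < m ] (if A u then count (not ∘ B) else count B)    ≡⟨ ∑-if A _ _ ⟩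
  count A * count (not ∘ B) + count (not ∘ A) * count B    ∎
  where
  open ≡-Reasoning
  count-xor : ∀ a → count (λ u' → a xor B u') ≡ (if a then count (not ∘ B) else count B)
  count-xor false = refl
  count-xor true  = refl

Majority : (G : Graph) → Subset (n G) → Fin (n G) → Set
Majority G B v = 1 ≤ deg G v × deg G v ≤ 2 * blackNbrs G B v

module _ (G : Graph) where

  majority⇒step : ∀ {B v} → Majority G B v → step G B v ≡ true
  majority⇒step {B} {v} (deg≥1 , half) with B v
  ... | true  = refl
  ... | false rewrite ⌊⌋-true (1 ≤? deg G v) deg≥1
                    | ⌊⌋-true (deg G v ≤? 2 * blackNbrs G B v) half = refl

  step⇒black⊎majority : ∀ {B v} → step G B v ≡ true → B v ≡ true ⊎ Majority G B v
  step⇒black⊎majority {B} {v} stepped with B v | 1 ≤? deg G v | deg G v ≤? 2 * blackNbrs G B v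
  ... | true  | _         | _        = inj₁ refl
  ... | false | yes deg≥1 | yes half = inj₂ (deg≥1 , half)
  ... | false | no  _     | _        = contradiction stepped λ ()
  ... | false | yes _     | no _     = contradiction stepped λ ()

  step-inflationary : ∀ B → B ⊆ step G B
  step-inflationary B v Bv rewrite Bv = refl

  blackNbrs-mono : ∀ {A B} → A ⊆ B → ∀ v → blackNbrs G A v ≤ blackNbrs G B v
  blackNbrs-mono A⊆B v = count-mono λ w → ∧-mono (adj G v w) (A⊆B w)
    where
    ∧-mono : ∀ a {b c} → (b ≡ true → c ≡ true) → a ∧ b ≡ true → a ∧ c ≡ true
    ∧-mono true b⇒c = b⇒c

  step-mono : ∀ {A B} → A ⊆ B → step G A ⊆ step G B
  step-mono {A} {B} A⊆B v stepped with step⇒black⊎majority stepped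
  ... | inj₁ Av             = step-inflationary B v (A⊆B v Av)
  ... | inj₂ (deg≥1 , half) =
    majority⇒step (deg≥1 , ≤-trans half (*-monoʳ-≤ 2 (blackNbrs-mono A⊆B v)))

  iter-mono : ∀ t {A B} → A ⊆ B → iter G t A ⊆ iter G t B
  iter-mono zero    A⊆B = A⊆B
  iter-mono (suc t) A⊆B = step-mono (iter-mono t A⊆B)

  iter-step : ∀ t B → iter G t (step G B) ≡ iter G (suc t) B
  iter-step zero    B = refl
  iter-step (suc t) B = cong (step G) (iter-step t B)

  iter-inflationary : ∀ B {s t} → s ≤ t → iter G s B ⊆ iter G t B
  iter-inflationary B s≤t = go (≤⇒≤′ s≤t)
    where
    go : ∀ {s t} → s ≤′ t → iter G s B ⊆ iter G t B
    go ≤′-refl                    v black = black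
    go {t = suc t} (≤′-step s≤′t) v black = step-inflationary (iter G t B) v (go s≤′t v black)

  complement-majority : ∀ B v → ¬ (deg G v ≤ 2 * blackNbrs G B v) →
                        deg G v ≤ 2 * blackNbrs G (not ∘ B) v
  complement-majority B v ¬half =
    subst (_≤ 2 * white) (sym split)
      (half-of-rest black white (¬half ∘ subst (_≤ 2 * black) (sym split)))
    where
    black = blackNbrs G B v
    white = blackNbrs G (not ∘ B) v
    split : deg G v ≡ black + white
    split = count-split (adj G v) B
    half-of-rest : ∀ x y → ¬ (x + y ≤ 2 * x) → x + y ≤ 2 * y
    half-of-rest x y ¬half with x ≤? y
    ... | yes x≤y = subst (x + y ≤_) (cong (y +_) (sym (+-identityʳ y))) (+-monoˡ-≤ y x≤y)
    ... | no  x≰y = contradiction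
      (subst (x + y ≤_) (cong (x +_) (sym (+-identityʳ x))) (+-monoʳ-≤ x (≰⇒≥ x≰y))) ¬half

_-_ : Subset k → Fin k → Subset k
(D - u) w = D w ∧ not ⌊ u ≟ w ⌋

remove-other : (D : Subset k) {u v : Fin k} → u ≢ v → (D - u) v ≡ D v
remove-other D {u} {v} u≢v =
  trans (cong (λ b → D v ∧ not b) (⌊⌋-false (u ≟ v) u≢v)) (∧-identityʳ (D v))

count-remove : (D : Subset k) (u : Fin k) → D u ≡ true → suc (count (D - u)) ≡ count D
count-remove D u Du = begin
  suc (count (D - u))                               ≡⟨ cong (_+ count (D - u)) only-u ⟨
  count (λ w → D w ∧ ⌊ u ≟ w ⌋) + count (D - u)     ≡⟨ count-split D (λ w → ⌊ u ≟ w ⌋) ⟨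
  count D                                           ∎
  where
  open ≡-Reasoning
  only-u : count (λ w → D w ∧ ⌊ u ≟ w ⌋) ≡ 1
  only-u = begin
    count (λ w → D w ∧ ⌊ u ≟ w ⌋)           ≡⟨ count≡∑bit (λ w → D w ∧ ⌊ u ≟ w ⌋) ⟩
    ∑[ w < _ ] bit (D w ∧ ⌊ u ≟ w ⌋)        ≡⟨ sum-cong-≗ (λ w → cong bit (∧-comm (D w) _)) ⟩
    ∑[ w < _ ] bit (⌊ u ≟ w ⌋ ∧ D w)        ≡⟨ ∑-bit-≟ u D ⟩
    bit (D u)                               ≡⟨ cong bit Du ⟩
    1                                       ∎

Loopless : Graph → Set
Loopless G = ∀ v → adj G v v ≡ false

IsMinimumDynamo : (G : Graph) → Subset (n G) → Set
IsMinimumDynamo G D = IsDynamo G D × (∀ D' → IsDynamo G D' → count D ≤ count D')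

MajorityOutside : (G : Graph) → Subset (n G) → Set
MajorityOutside G D = ∀ u → D u ≡ true → Majority G (not ∘ D) u

module _ (G : Graph) where

  blackNbrs-remove : ∀ D u → adj G u u ≡ false → blackNbrs G (D - u) u ≡ blackNbrs G D u
  blackNbrs-remove D u loopless = count-cong agree
    where
    agree : ∀ w → adj G u w ∧ (D - u) w ≡ adj G u w ∧ D w
    agree w with u ≟ w
    ... | yes refl rewrite loopless = refl
    ... | no  _    = cong (adj G u w ∧_) (∧-identityʳ (D w))

  dynamo-remove : ∀ {D u} → adj G u u ≡ false → Majority G D u → IsDynamo G D → IsDynamo G (D - u)
  dynamo-remove {D} {u} loopless (deg≥1 , half) (t , all-black) =
    suc t , λ v →
      subst (λ B → B v ≡ true) (iter-step G t (D - u)) (iter-mono G t D⊆step v (all-black v))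
    where
    D⊆step : D ⊆ step G (D - u)
    D⊆step v Dv = case u ≟ v of λ where
      (yes refl) → majority⇒step G
        (deg≥1 , subst (λ x → deg G u ≤ 2 * x) (sym (blackNbrs-remove D u loopless)) half)
      (no u≢v)   → step-inflationary G (D - u) v (trans (remove-other D u≢v) Dv)

  minimum-dynamo⇒majorityOutside : Loopless G → NoIsolated G → ∀ {D} → IsMinimumDynamo G D →
                                   MajorityOutside G D
  minimum-dynamo⇒majorityOutside loopless no-isolated {D} (dynamo , minimum) u Du =
    no-isolated u , complement-majority G D u ¬half
    where
    ¬half : ¬ (deg G u ≤ 2 * blackNbrs G D u)
    ¬half half = <⇒≱ (≤-reflexive (count-remove D u Du))
      (minimum (D - u) (dynamo-remove (loopless u) (no-isolated u , half) dynamo))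

deg≡blackNbrs-all : (G : Graph) (v : Fin (n G)) → deg G v ≡ blackNbrs G (λ _ → true) v
deg≡blackNbrs-all G v = count-cong (λ w → sym (∧-identityʳ (adj G v w)))

module _ {G H : Graph} where

  adj-□ : ∀ u u' w w' → adj (G □ H) (combine u u') (combine w w') ≡
          (⌊ u ≟ w ⌋ ∧ adj H u' w') ∨ (⌊ u' ≟ w' ⌋ ∧ adj G u w)
  adj-□ u u' w w' = cong₂ adjPair (remQuot-combine u u') (remQuot-combine w w')
    where
    adjPair : Fin (n G) × Fin (n H) → Fin (n G) × Fin (n H) → Bool
    adjPair (u , u') (w , w') = (⌊ u ≟ w ⌋ ∧ adj H u' w') ∨ (⌊ u' ≟ w' ⌋ ∧ adj G u w)

  -- Without a loop at u, no vertex is both a G-fibre and an H-fibre neighbour of (u , u').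
  bit-adj-□ : ∀ {u u'} → adj G u u ≡ false → ∀ w w' q →
              bit (adj (G □ H) (combine u u') (combine w w') ∧ q) ≡
              bit (⌊ u ≟ w ⌋ ∧ (adj H u' w' ∧ q)) + bit (⌊ u' ≟ w' ⌋ ∧ (adj G u w ∧ q))
  bit-adj-□ {u} {u'} loopless w w' q rewrite adj-□ u u' w w' with u ≟ w | u' ≟ w'
  ... | no _     | yes refl = refl
  ... | no _     | no _     = refl
  ... | yes refl | yes refl rewrite loopless | ∨-identityʳ (adj H u' u') = sym (+-identityʳ _)
  ... | yes refl | no _     rewrite ∨-identityʳ (adj H u' w') = sym (+-identityʳ _)

  blackNbrs-□ : ∀ (Q : Subset (n G * n H)) {u u'} → adj G u u ≡ false →
                blackNbrs (G □ H) Q (combine u u') ≡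
                blackNbrs H (Q ∘ combine u) u' + blackNbrs G (λ w → Q (combine w u')) u
  blackNbrs-□ Q {u} {u'} loopless = begin
    blackNbrs (G □ H) Q (combine u u')
      ≡⟨ count≡∑bit (λ j → adj (G □ H) (combine u u') j ∧ Q j) ⟩
    ∑[ j < n G * n H ] bit (adj (G □ H) (combine u u') j ∧ Q j)
      ≡⟨ sum-combine {n G} _ ⟩
    ∑[ w < n G ] ∑[ w' < n H ] bit (adj (G □ H) (combine u u') (combine w w') ∧ q w w')
      ≡⟨ sum-cong-≗ (λ w → sum-cong-≗ (λ w' → bit-adj-□ loopless w w' (q w w'))) ⟩
    ∑[ w < n G ] ∑[ w' < n H ] (fibreH w w' + fibreG w w')
      ≡⟨ sum-cong-≗ (λ w → ∑-distrib-+ (fibreH w) (fibreG w)) ⟩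
    ∑[ w < n G ] (∑[ w' < n H ] fibreH w w' + ∑[ w' < n H ] fibreG w w')
      ≡⟨ ∑-distrib-+ (λ w → ∑[ w' < n H ] fibreH w w') (λ w → ∑[ w' < n H ] fibreG w w') ⟩
    ∑[ w < n G ] ∑[ w' < n H ] fibreH w w' + ∑[ w < n G ] ∑[ w' < n H ] fibreG w w'
      ≡⟨ cong (_+ ∑[ w < n G ] ∑[ w' < n H ] fibreG w w') (∑-comm fibreH) ⟩
    ∑[ w' < n H ] ∑[ w < n G ] fibreH w w' + ∑[ w < n G ] ∑[ w' < n H ] fibreG w w'
      ≡⟨ cong₂ _+_ (sum-cong-≗ (λ w' → ∑-bit-≟ u (λ w → adj H u' w' ∧ q w w')))
                  (sum-cong-≗ (λ w → ∑-bit-≟ u' (λ w' → adj G u w ∧ q w w'))) ⟩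
    ∑[ w' < n H ] bit (adj H u' w' ∧ q u w') + ∑[ w < n G ] bit (adj G u w ∧ q w u')
      ≡⟨ cong₂ _+_ (count≡∑bit (λ w' → adj H u' w' ∧ q u w')) (count≡∑bit (λ w → adj G u w ∧ q w u')) ⟨
    blackNbrs H (Q ∘ combine u) u' + blackNbrs G (λ w → Q (combine w u')) u
      ∎
    where
    open ≡-Reasoning
    q : Fin (n G) → Fin (n H) → Bool
    q w w' = Q (combine w w')
    fibreH fibreG : Fin (n G) → Fin (n H) → ℕ
    fibreH w w' = bit (⌊ u ≟ w ⌋ ∧ (adj H u' w' ∧ q w w'))
    fibreG w w' = bit (⌊ u' ≟ w' ⌋ ∧ (adj G u w ∧ q w w'))

  deg-□ : ∀ {u u'} → adj G u u ≡ false → deg (G □ H) (combine u u') ≡ deg H u' + deg G u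
  deg-□ {u} {u'} loopless = begin
    deg (G □ H) (combine u u')                                          ≡⟨ deg≡blackNbrs-all (G □ H) _ ⟩
    blackNbrs (G □ H) (λ _ → true) (combine u u')                       ≡⟨ blackNbrs-□ _ loopless ⟩
    blackNbrs H (λ _ → true) u' + blackNbrs G (λ _ → true) u            ≡⟨ cong₂ _+_ (deg≡blackNbrs-all H u') (deg≡blackNbrs-all G u) ⟨
    deg H u' + deg G u                                                  ∎
    where open ≡-Reasoning

  majority-□ : ∀ {B BG BH u u'} → adj G u u ≡ false → Majority G BG u → Majority H BH u' →
               BG ⊆ (λ w → B (combine w u')) → BH ⊆ (B ∘ combine u) →
               Majority (G □ H) B (combine u u')
  majority-□ {B} {BG} {BH} {u} {u'} loopless (degG≥1 , halfG) (_ , halfH) BG⊆ BH⊆ =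
    subst (1 ≤_) (sym (deg-□ loopless)) (≤-trans degG≥1 (m≤n+m _ _)) , half
    where
    open ≤-Reasoning
    half : deg (G □ H) (combine u u') ≤ 2 * blackNbrs (G □ H) B (combine u u')
    half = begin
      deg (G □ H) (combine u u')                          ≡⟨ deg-□ loopless ⟩
      deg H u' + deg G u                                  ≤⟨ +-mono-≤ halfH halfG ⟩
      2 * blackNbrs H BH u' + 2 * blackNbrs G BG u        ≡⟨ *-distribˡ-+ 2 (blackNbrs H BH u') (blackNbrs G BG u) ⟨
      2 * (blackNbrs H BH u' + blackNbrs G BG u)          ≤⟨ *-monoʳ-≤ 2 (+-mono-≤ (blackNbrs-mono H BH⊆ u') (blackNbrs-mono G BG⊆ u)) ⟩
      2 * (blackNbrs H (B ∘ combine u) u' + blackNbrs G (λ w → B (combine w u')) u)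
                                                          ≡⟨ cong (2 *_) (blackNbrs-□ B loopless) ⟨
      2 * blackNbrs (G □ H) B (combine u u')              ∎

module _ {G H : Graph} (loopless-G : Loopless G) {DG DH}
         (outside-G : MajorityOutside G DG) (outside-H : MajorityOutside H DH) where

  ⊕-step : ∀ {u u'} → DG u ≡ true ⊎ DH u' ≡ true → step (G □ H) (DG ⊕ DH) (combine u u') ≡ true
  ⊕-step {u} {u'} in-D with DG u in DGu | DH u' in DHu'
  ... | true  | true  = majority⇒step (G □ H)
    (majority-□ {G} {H} (loopless-G u) (outside-G u DGu) (outside-H u' DHu') G-fibre H-fibre)
    where
    G-fibre : (not ∘ DG) ⊆ (λ w → (DG ⊕ DH) (combine w u'))
    G-fibre w white =
      trans (⊕-combine DG DH w u') (trans (cong (DG w xor_) DHu') (trans (xor-comm (DG w) true) white))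
    H-fibre : (not ∘ DH) ⊆ ((DG ⊕ DH) ∘ combine u)
    H-fibre w' white = trans (⊕-combine DG DH u w') (trans (cong (_xor DH w') DGu) white)
  ... | true  | false =
    step-inflationary (G □ H) (DG ⊕ DH) _ (trans (⊕-combine DG DH u u') (cong₂ _xor_ DGu DHu'))
  ... | false | true  =
    step-inflationary (G □ H) (DG ⊕ DH) _ (trans (⊕-combine DG DH u u') (cong₂ _xor_ DGu DHu'))
  ... | false | false = contradiction in-D λ { (inj₁ ()) ; (inj₂ ()) }

  realign : ∀ i j → iter (G □ H) (suc (suc i + j)) (DG ⊕ DH) ⊆
                    iter (G □ H) (suc (i + suc j)) (DG ⊕ DH)
  realign i j = iter-inflationary (G □ H) (DG ⊕ DH) (≤-reflexive (cong suc (sym (+-suc i j))))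

  spread : ∀ i j {u u'} → iter G i DG u ≡ true → iter H j DH u' ≡ true →
           iter (G □ H) (suc (i + j)) (DG ⊕ DH) (combine u u') ≡ true
  spread zero    j       hu hu' =
    iter-inflationary (G □ H) (DG ⊕ DH) {1} {suc j} (s≤s z≤n) _ (⊕-step (inj₁ hu))
  spread (suc i) zero    hu hu' =
    iter-inflationary (G □ H) (DG ⊕ DH) {1} {suc (suc i + 0)} (s≤s z≤n) _ (⊕-step (inj₂ hu'))
  spread (suc i) (suc j) {u} {u'} hu hu' with step⇒black⊎majority G hu | step⇒black⊎majority H hu'
  ... | inj₁ hu₀ | _         = step-inflationary (G □ H) _ _ (spread i (suc j) hu₀ hu')
  ... | inj₂ _   | inj₁ hu'₀ = step-inflationary (G □ H) _ _ (realign i j _ (spread (suc i) j hu hu'₀))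
  ... | inj₂ mG  | inj₂ mH   = majority⇒step (G □ H)
    (majority-□ {G} {H} (loopless-G u) mG mH
      (λ w hw → spread i (suc j) hw hu')
      (λ w' hw' → realign i j _ (spread (suc i) j hu hw')))

  ⊕-dynamo : IsDynamo G DG → IsDynamo H DH → IsDynamo (G □ H) (DG ⊕ DH)
  ⊕-dynamo (tG , all-G) (tH , all-H) = suc (tG + tH) , λ v →
    subst (λ v → iter (G □ H) (suc (tG + tH)) (DG ⊕ DH) v ≡ true) (combine-remQuot {n G} (n H) v)
      (spread tG tH (all-G _) (all-H _))

theorem5 : (G H : Graph) → IsSimple G → IsSimple H → NoIsolated G → NoIsolated H →
    (a b c : ℕ) → IsMinDynamoSize G a → IsMinDynamoSize H b → IsMinDynamoSize (G □ H) c →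
    c + 2 * a * b ≤ a * n H + b * n G
theorem5 G H (_ , loopless-G) (_ , loopless-H) no-isolated-G no-isolated-H _ _ c
         ((DG , dynamo-G , refl) , minimum-G) ((DH , dynamo-H , refl) , minimum-H) (_ , minimum-c) = begin
  c + 2 * count DG * count DH
    ≤⟨ +-monoˡ-≤ _ (minimum-c (DG ⊕ DH) (⊕-dynamo loopless-G outside-G outside-H dynamo-G dynamo-H)) ⟩
  count (DG ⊕ DH) + 2 * count DG * count DH
    ≡⟨ cong (_+ 2 * count DG * count DH) (count-⊕ DG DH) ⟩
  count DG * count (not ∘ DH) + count (not ∘ DG) * count DH + 2 * count DG * count DH
    ≡⟨ regroup (count DG) (count (not ∘ DG)) (count DH) (count (not ∘ DH)) ⟩
  count DG * (count DH + count (not ∘ DH)) + count DH * (count DG + count (not ∘ DG))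
    ≡⟨ cong₂ (λ p q → count DG * p + count DH * q) (count-complement DH) (count-complement DG) ⟩
  count DG * n H + count DH * n G
    ∎
  where
  open ≤-Reasoning
  outside-G : MajorityOutside G DG
  outside-G = minimum-dynamo⇒majorityOutside G loopless-G no-isolated-G (dynamo-G , minimum-G)
  outside-H : MajorityOutside H DH
  outside-H = minimum-dynamo⇒majorityOutside H loopless-H no-isolated-H (dynamo-H , minimum-H)
  regroup : ∀ a a' b b' → a * b' + a' * b + 2 * a * b ≡ a * (b + b') + b * (a + a')
  regroup = solve-∀
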